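{- For every integer $n \geq 5$, $$|E(\mathcal{R}_n)| = |E(\Gamma_n)| - |E(\Gamma_{n-4})|,$$ and the generating function of the edge numbers of the Fibonacci-run graphs is $$\sum_{n \geq 1} |E(\mathcal{R}_n)|\, t^n = \frac{t(1-t^4)}{(1-t-t^2)^2} = t + 2t^2 + 5t^3 + 10t^4 + 19t^5 + 36t^6 + \cdots.$$
   Context: A binary string is called run-constrained if every run (maximal block) of consecutive $1$s in it is immediately followed by a run of $0$s of strictly greater length. For $n \geq 1$, the Fibonacci-run graph $\mathcal{R}_n$ has vertex set $\{ w \in \{0,1\}^n : w00 \text{ is a run-constrained string of length } n+2\}$, and two vertices are adjacent iff they differ in exactly one coordinate. The Fibonacci cube $\Gamma_n$ is the subgraph of the hypercube $Q_n$ induced by the binary strings of length $n$ containing no two consecutive $1$s (two vertices adjacent iff they differ in exactly one coordinate). -}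

module Defs where

open import Data.Bool using (Bool; true; false; _∧_; not; if_then_else_)
open import Data.Nat using (ℕ; zero; suc; _<ᵇ_; _≡ᵇ_)
open import Data.Integer as ℤ using (ℤ; +_)
open import Data.List using (List; []; _∷_; _++_; map; concatMap; filter; length; upTo)
open import Data.Vec using (Vec; []; _∷_; toList)
open import Data.Product using (_×_; _,_; proj₁; proj₂)
open import Relation.Nullary using (Dec; yes; no)
open import Relation.Binary.PropositionalEquality using (_≡_)
open import Data.Bool.Properties using () renaming (_≟_ to _≟ᴮ_)

-- Scanned left to right by a finite-state reader:
--   outside      : not inside a run of 1s that still needs its 0-run checked
--   ones k       : inside a maximal run of 1s, of length k so far
--   zeros k m    : inside the run of 0s immediately following a run of
--                  1s of length k; m zeros read so far
-- When a 1-run is closed (by a 1 after its 0-run, or by the end of the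
-- string) we require k < m.  A 1-run at the very end has an empty
-- following 0-run and hence fails.

data State : Set where
  outside : State
  ones    : ℕ → State
  zeros   : ℕ → ℕ → State

scan : State → List Bool → Bool
scan outside     []            = true
scan (ones k)    []            = false
scan (zeros k m) []            = k <ᵇ m
scan outside     (false ∷ xs)  = scan outside xs
scan outside     (true ∷ xs)   = scan (ones 1) xs
scan (ones k)    (true ∷ xs)   = scan (ones (suc k)) xs
scan (ones k)    (false ∷ xs)  = scan (zeros k 1) xs
scan (zeros k m) (false ∷ xs)  = scan (zeros k (suc m)) xs
scan (zeros k m) (true ∷ xs)   = (k <ᵇ m) ∧ scan (ones 1) xs

runConstrained : List Bool → Bool
runConstrained = scan outside

isRunVertex : {n : ℕ} → Vec Bool n → Bool
isRunVertex w = runConstrained (toList w ++ (false ∷ false ∷ []))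

noTwoOnes : List Bool → Bool
noTwoOnes []                 = true
noTwoOnes (x ∷ [])           = true
noTwoOnes (true ∷ true ∷ xs) = false
noTwoOnes (x ∷ y ∷ xs)       = noTwoOnes (y ∷ xs)

isFibVertex : {n : ℕ} → Vec Bool n → Bool
isFibVertex w = noTwoOnes (toList w)

allWords : (n : ℕ) → List (Vec Bool n)
allWords zero    = [] ∷ []
allWords (suc n) = concatMap (λ w → (false ∷ w) ∷ (true ∷ w) ∷ []) (allWords n)

hamming : {n : ℕ} → Vec Bool n → Vec Bool n → ℕ
hamming []       []       = 0
hamming (x ∷ xs) (y ∷ ys) with x ≟ᴮ y
... | yes _ = hamming xs ys
... | no  _ = suc (hamming xs ys)

pairs : {A : Set} → List A → List (A × A)
pairs []       = []
pairs (x ∷ xs) = map (λ y → (x , y)) xs ++ pairs xs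

inducedEdges : (n : ℕ) → (Vec Bool n → Bool) → ℕ
inducedEdges n P =
  length (filter (λ p → hamming (proj₁ p) (proj₂ p) Data.Nat.≟ 1)
                 (pairs (filter (λ w → P w ≟ᴮ true) (allWords n))))

edgesR : ℕ → ℕ
edgesR n = inducedEdges n isRunVertex

edgesΓ : ℕ → ℕ
edgesΓ n = inducedEdges n isFibVertex

Series : Set
Series = ℕ → ℤ

sumTo : ℕ → (ℕ → ℤ) → ℤ
sumTo zero    f = f 0
sumTo (suc n) f = sumTo n f ℤ.+ f (suc n)

_⊛_ : Series → Series → Series
(f ⊛ g) n = sumTo n (λ k → f k ℤ.* g (n Data.Nat.∸ k))

poly : List ℤ → Series
poly []       _       = + 0
poly (c ∷ cs) zero    = c
poly (c ∷ cs) (suc n) = poly cs n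

oneMinusTMinusT² : Series
oneMinusTMinusT² = poly (+ 1 ∷ ℤ.- + 1 ∷ ℤ.- + 1 ∷ [])

tTimesOneMinusT⁴ : Series
tTimesOneMinusT⁴ = poly (+ 0 ∷ + 1 ∷ + 0 ∷ + 0 ∷ + 0 ∷ ℤ.- + 1 ∷ [])

edgeGF : Series
edgeGF zero    = + 0
edgeGF (suc n) = + edgesR (suc n)

-- Twice the number of edges of an induced subgraph of Qₙ is its degree sum D. Splitting
-- words by their first letter splits a vertex set V ⊆ {0,1}ⁿ⁺¹ into the sets V₀ and V₁ of
-- tails of its words starting with 0 and with 1; the edges between the two halves form
-- the matching 0w ~ 1w on V₀ ∩ V₁, so D(V) = D(V₀) + 2 |V₀ ∩ V₁| + D(V₁).
-- For the Fibonacci cube this gives |E(Γₙ₊₂)| = |E(Γₙ₊₁)| + F(n+2) + |E(Γₙ)|.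
-- For Rₙ the tail sets are the languages of the states of the automaton reading w00.
-- These languages are ordered by inclusion according to how many zeros the state still
-- owes, which determines all the intersections. Inside a run of j + 2 ones, words of length
-- n + 1 give the same counts as words of length n inside a run of j + 1 ones, which closes
-- the recursion and yields |E(Rₙ₊₄)| + F(n) = |E(Rₙ₊₃)| + F(n+4) + |E(Rₙ₊₂)|.
-- The two recurrences give |E(Rₙ₊₄)| + |E(Γₙ)| = |E(Γₙ₊₄)| by induction, and applying
-- 1 - t - t² twice to the second one kills the Fibonacci terms, which is the
-- generating-function identity.

module Submission where

open import Defs
open import Data.Nat using (ℕ; _≤_; _∸_)
open import Data.Integer using (+_; _-_)
open import Data.Product using (_×_)
open import Relation.Binary.PropositionalEquality using (_≡_)

open import Algebra.Properties.CommutativeSemigroup using (interchange)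
open import Data.Bool using (Bool; true; false; _∧_; T)
open import Data.Bool.Properties using (∧-comm; ∧-zeroʳ; T-∧) renaming (_≟_ to _≟ᴮ_)
open import Data.Empty using (⊥-elim)
open import Data.Integer using (ℤ)
import Data.Integer as ℤ
import Data.Integer.Properties as ℤᵖ
import Data.Integer.Tactic.RingSolver as ℤSolver
open import Data.List using (List; []; _∷_; _++_; map; filter; length; concatMap)
open import Data.List.Properties using (map-cong; map-++; map-∘)
open import Data.Nat using (zero; suc; _+_; _*_; _<_; _≡ᵇ_; _<ᵇ_; z≤n; s≤s)
open import Data.Nat.ListAction using (sum)
open import Data.Nat.ListAction.Properties using (sum-++)
open import Data.Nat.Properties
  using ( +-identityʳ; +-comm; +-suc; *-zeroʳ; *-distribˡ-+; +-commutativeSemigroup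
        ; +-cancelʳ-≡; *-cancelˡ-≡; ≤-refl; m≤n+m; +-monoʳ-<; +-cancelˡ-<; m<n⇒m<1+n
        ; <⇒<ᵇ; <ᵇ⇒<; module ≤-Reasoning )
open import Data.Nat.Tactic.RingSolver using (solve-∀)
open import Data.Product using (_,_; proj₁; proj₂)
open import Data.Unit using (tt)
open import Data.Vec using (Vec; []; _∷_; toList)
open import Function using (_∘_; Equivalence)
open import Level using (0ℓ)
open import Relation.Binary.PropositionalEquality
  using (refl; sym; trans; cong; cong₂; _≗_; module ≡-Reasoning)
open import Relation.Nullary using (does)
open import Relation.Unary using (Pred; Decidable)

χ : Bool → ℕ
χ false = 0
χ true  = 1

χ-∧ : ∀ a b → χ (a ∧ b) ≡ χ a * χ b
χ-∧ false b = refl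
χ-∧ true  b = sym (+-identityʳ (χ b))

∧-absorbs : ∀ {a b} → (T a → T b) → a ∧ b ≡ a
∧-absorbs {false}         _   = refl
∧-absorbs {true}  {true}  _   = refl
∧-absorbs {true}  {false} a⇒b = ⊥-elim (a⇒b tt)

T-injective : ∀ {a b} → (T a → T b) → (T b → T a) → a ≡ b
T-injective {a} {b} a⇒b b⇒a = trans (sym (∧-absorbs a⇒b)) (trans (∧-comm a b) (∧-absorbs b⇒a))

private variable A B : Set

∑ : List A → (A → ℕ) → ℕ
∑ xs f = sum (map f xs)

∑-cong : ∀ xs {f g : A → ℕ} → f ≗ g → ∑ xs f ≡ ∑ xs g
∑-cong xs f≗g = cong sum (map-cong f≗g xs)

∑-zero : ∀ xs {f : A → ℕ} → (∀ x → f x ≡ 0) → ∑ xs f ≡ 0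
∑-zero []       f≡0 = refl
∑-zero (x ∷ xs) f≡0 = cong₂ _+_ (f≡0 x) (∑-zero xs f≡0)

∑-+ : ∀ xs (f g : A → ℕ) → ∑ xs (λ x → f x + g x) ≡ ∑ xs f + ∑ xs g
∑-+ []       f g = refl
∑-+ (x ∷ xs) f g = trans (cong (_+_ (f x + g x)) (∑-+ xs f g))
                         (interchange +-commutativeSemigroup (f x) (g x) (∑ xs f) (∑ xs g))

∑-*ˡ : ∀ xs c (f : A → ℕ) → ∑ xs (λ x → c * f x) ≡ c * ∑ xs f
∑-*ˡ []       c f = sym (*-zeroʳ c)
∑-*ˡ (x ∷ xs) c f = trans (cong (_+_ (c * f x)) (∑-*ˡ xs c f)) (sym (*-distribˡ-+ c (f x) (∑ xs f)))

∑-++ : ∀ xs ys (f : A → ℕ) → ∑ (xs ++ ys) f ≡ ∑ xs f + ∑ ys f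
∑-++ xs ys f = trans (cong sum (map-++ f xs ys)) (sum-++ (map f xs) (map f ys))

∑-map : ∀ (g : B → A) xs (f : A → ℕ) → ∑ (map g xs) f ≡ ∑ xs (f ∘ g)
∑-map g xs f = cong sum (sym (map-∘ xs))

∑-concatMap : ∀ (g : B → List A) xs (f : A → ℕ) →
              ∑ (concatMap g xs) f ≡ ∑ xs (λ x → ∑ (g x) f)
∑-concatMap g []       f = refl
∑-concatMap g (x ∷ xs) f =
  trans (∑-++ (g x) (concatMap g xs) f) (cong (_+_ (∑ (g x) f)) (∑-concatMap g xs f))

length-filter : ∀ {P : Pred A 0ℓ} (P? : Decidable P) xs → length (filter P? xs) ≡ ∑ xs (χ ∘ does ∘ P?)
length-filter P? []       = refl
length-filter P? (x ∷ xs) with does (P? x)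
... | true  = cong suc (length-filter P? xs)
... | false = length-filter P? xs

∑-filter : ∀ (P : A → Bool) xs (f : A → ℕ) →
           ∑ (filter (λ x → P x ≟ᴮ true) xs) f ≡ ∑ xs (λ x → χ (P x) * f x)
∑-filter P []       f = refl
∑-filter P (x ∷ xs) f with P x
... | true  = cong₂ _+_ (sym (+-identityʳ (f x))) (∑-filter P xs f)
... | false = ∑-filter P xs f

∑-pairs : {A : Set} (f : A → A → ℕ) → (∀ x y → f x y ≡ f y x) → (∀ x → f x x ≡ 0) →
          ∀ xs → 2 * ∑ (pairs xs) (λ p → f (proj₁ p) (proj₂ p)) ≡ ∑ xs (λ x → ∑ xs (f x))
∑-pairs f sym-f diag-f []       = refl
∑-pairs {A} f sym-f diag-f (x ∷ xs) = begin
    2 * ∑ (map (x ,_) xs ++ pairs xs) f̃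
  ≡⟨ cong (2 *_) (trans (∑-++ (map (x ,_) xs) (pairs xs) f̃)
                        (cong (_+ ∑ (pairs xs) f̃) (∑-map (x ,_) xs f̃))) ⟩
    2 * (∑ xs (f x) + ∑ (pairs xs) f̃)
  ≡⟨ trans (*-distribˡ-+ 2 (∑ xs (f x)) _) (cong (_+_ (2 * ∑ xs (f x))) (∑-pairs f sym-f diag-f xs)) ⟩
    2 * ∑ xs (f x) + ∑ xs (λ z → ∑ xs (f z))
  ≡⟨ double-+ (∑ xs (f x)) _ ⟩
    ∑ xs (f x) + (∑ xs (f x) + ∑ xs (λ z → ∑ xs (f z)))
  ≡⟨ cong₂ (λ d c → d + ∑ xs (f x) + (c + ∑ xs (λ z → ∑ xs (f z))))
           (sym (diag-f x)) (∑-cong xs (sym-f x)) ⟩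
    f x x + ∑ xs (f x) + (∑ xs (λ z → f z x) + ∑ xs (λ z → ∑ xs (f z)))
  ≡⟨ cong (_+_ (f x x + ∑ xs (f x))) (sym (∑-+ xs (λ z → f z x) (λ z → ∑ xs (f z)))) ⟩
    ∑ (x ∷ xs) (λ z → ∑ (x ∷ xs) (f z))
  ∎
  where
  open ≡-Reasoning
  f̃ : A × A → ℕ
  f̃ p = f (proj₁ p) (proj₂ p)
  double-+ : ∀ a b → 2 * a + b ≡ a + (a + b)
  double-+ = solve-∀

private variable n : ℕ

∑Q : (n : ℕ) → (Vec Bool n → ℕ) → ℕ
∑Q n = ∑ (allWords n)

∑Q-suc : ∀ n f → ∑Q (suc n) f ≡ ∑Q n (λ w → f (false ∷ w)) + ∑Q n (λ w → f (true ∷ w))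
∑Q-suc n f = begin
    ∑ (concatMap (λ w → (false ∷ w) ∷ (true ∷ w) ∷ []) (allWords n)) f
  ≡⟨ ∑-concatMap _ (allWords n) f ⟩
    ∑Q n (λ w → f (false ∷ w) + (f (true ∷ w) + 0))
  ≡⟨ ∑-cong (allWords n) (λ w → cong (_+_ (f (false ∷ w))) (+-identityʳ (f (true ∷ w)))) ⟩
    ∑Q n (λ w → f (false ∷ w) + f (true ∷ w))
  ≡⟨ ∑-+ (allWords n) _ _ ⟩
    ∑Q n (λ w → f (false ∷ w)) + ∑Q n (λ w → f (true ∷ w))
  ∎
  where open ≡-Reasoning

∑Q-δ : ∀ n (x : Vec Bool n) (f : Vec Bool n → Bool) →
       ∑Q n (λ y → χ ((hamming x y ≡ᵇ 0) ∧ f y)) ≡ χ (f x)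
∑Q-δ zero    []          f = +-identityʳ (χ (f []))
∑Q-δ (suc n) (false ∷ x) f = trans (∑Q-suc n _)
  (trans (cong₂ _+_ (∑Q-δ n x (λ y → f (false ∷ y))) (∑-zero (allWords n) (λ _ → refl)))
         (+-identityʳ _))
∑Q-δ (suc n) (true ∷ x)  f = trans (∑Q-suc n _)
  (cong₂ _+_ (∑-zero (allWords n) (λ _ → refl)) (∑Q-δ n x (λ y → f (true ∷ y))))

hamming-sym : (x y : Vec Bool n) → hamming x y ≡ hamming y x
hamming-sym []          []          = refl
hamming-sym (false ∷ x) (false ∷ y) = hamming-sym x y
hamming-sym (false ∷ x) (true ∷ y)  = cong suc (hamming-sym x y)
hamming-sym (true ∷ x)  (false ∷ y) = cong suc (hamming-sym x y)
hamming-sym (true ∷ x)  (true ∷ y)  = hamming-sym x y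

hamming-refl : (x : Vec Bool n) → hamming x x ≡ 0
hamming-refl []          = refl
hamming-refl (false ∷ x) = hamming-refl x
hamming-refl (true ∷ x)  = hamming-refl x

WordPred : ℕ → Set
WordPred n = Vec Bool n → Bool

∂ : Bool → WordPred (suc n) → WordPred n
∂ b P w = P (b ∷ w)

_∩_ : WordPred n → WordPred n → WordPred n
(P ∩ Q) w = P w ∧ Q w

∅ : WordPred n
∅ _ = false

_⊆_ : WordPred n → WordPred n → Set
P ⊆ Q = ∀ w → T (P w) → T (Q w)

count : (n : ℕ) → WordPred n → ℕ
count n P = ∑Q n (λ w → χ (P w))

adjacent : Vec Bool n → Vec Bool n → Bool
adjacent x y = hamming x y ≡ᵇ 1

degreeSum : (n : ℕ) → WordPred n → ℕ
degreeSum n P = ∑Q n λ x → ∑Q n λ y → χ (adjacent x y ∧ P x ∧ P y)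

count-suc : ∀ n (P : WordPred (suc n)) → count (suc n) P ≡ count n (∂ false P) + count n (∂ true P)
count-suc n P = ∑Q-suc n (λ w → χ (P w))

count-cong : ∀ n {P Q : WordPred n} → P ≗ Q → count n P ≡ count n Q
count-cong n P≗Q = ∑-cong (allWords n) (cong χ ∘ P≗Q)

count-∅ : ∀ n → count n ∅ ≡ 0
count-∅ n = ∑-zero (allWords n) (λ _ → refl)

count-∩-comm : ∀ n (P Q : WordPred n) → count n (P ∩ Q) ≡ count n (Q ∩ P)
count-∩-comm n P Q = count-cong n (λ w → ∧-comm (P w) (Q w))

count-∩-⊆ : ∀ n {P Q : WordPred n} → P ⊆ Q → count n (P ∩ Q) ≡ count n P
count-∩-⊆ n P⊆Q = count-cong n (λ w → ∧-absorbs (P⊆Q w))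

count-suc-∅ : ∀ n (P : WordPred (suc n)) → ∂ true P ≗ ∅ → count (suc n) P ≡ count n (∂ false P)
count-suc-∅ n P P₁≗∅ = trans (count-suc n P)
  (trans (cong (_+_ (count n (∂ false P))) (trans (count-cong n P₁≗∅) (count-∅ n))) (+-identityʳ _))

degreeSum-cong : ∀ n {P Q : WordPred n} → P ≗ Q → degreeSum n P ≡ degreeSum n Q
degreeSum-cong n P≗Q = ∑-cong (allWords n) λ x → ∑-cong (allWords n) λ y →
  cong₂ (λ a b → χ (adjacent x y ∧ a ∧ b)) (P≗Q x) (P≗Q y)

degreeSum-∅ : ∀ n → degreeSum n ∅ ≡ 0
degreeSum-∅ n = ∑-zero (allWords n) λ x → ∑-zero (allWords n) λ y → cong χ (∧-zeroʳ (adjacent x y))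

neighbours-false∷ : ∀ n (x : Vec Bool n) (f : WordPred (suc n)) →
  ∑Q (suc n) (λ y → χ (adjacent (false ∷ x) y ∧ f y))
  ≡ ∑Q n (λ y → χ (adjacent x y ∧ f (false ∷ y))) + χ (f (true ∷ x))
neighbours-false∷ n x f = trans (∑Q-suc n _)
  (cong (_+_ (∑Q n (λ y → χ (adjacent x y ∧ f (false ∷ y))))) (∑Q-δ n x (λ y → f (true ∷ y))))

neighbours-true∷ : ∀ n (x : Vec Bool n) (f : WordPred (suc n)) →
  ∑Q (suc n) (λ y → χ (adjacent (true ∷ x) y ∧ f y))
  ≡ χ (f (false ∷ x)) + ∑Q n (λ y → χ (adjacent x y ∧ f (true ∷ y)))
neighbours-true∷ n x f = trans (∑Q-suc n _)
  (cong (_+ ∑Q n (λ y → χ (adjacent x y ∧ f (true ∷ y)))) (∑Q-δ n x (λ y → f (false ∷ y))))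

degreeSum-suc : ∀ n (P : WordPred (suc n)) →
  degreeSum (suc n) P
  ≡ degreeSum n (∂ false P) + 2 * count n (∂ true P ∩ ∂ false P) + degreeSum n (∂ true P)
degreeSum-suc n P = begin
    degreeSum (suc n) P
  ≡⟨ ∑Q-suc n _ ⟩
    ∑Q n (λ x → ∑Q (suc n) (λ y → χ (adjacent (false ∷ x) y ∧ P (false ∷ x) ∧ P y)))
    + ∑Q n (λ x → ∑Q (suc n) (λ y → χ (adjacent (true ∷ x) y ∧ P (true ∷ x) ∧ P y)))
  ≡⟨ cong₂ _+_ (trans (∑-cong (allWords n) (λ x → neighbours-false∷ n x _)) (∑-+ (allWords n) _ _))
               (trans (∑-cong (allWords n) (λ x → neighbours-true∷ n x _)) (∑-+ (allWords n) _ _)) ⟩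
    (d₀ + count n (P₀ ∩ P₁)) + (count n (P₁ ∩ P₀) + d₁)
  ≡⟨ cong (λ c → (d₀ + c) + (count n (P₁ ∩ P₀) + d₁)) (count-∩-comm n P₀ P₁) ⟩
    (d₀ + count n (P₁ ∩ P₀)) + (count n (P₁ ∩ P₀) + d₁)
  ≡⟨ regroup d₀ (count n (P₁ ∩ P₀)) d₁ ⟩
    d₀ + 2 * count n (P₁ ∩ P₀) + d₁
  ∎
  where
  open ≡-Reasoning
  P₀ P₁ : WordPred n
  P₀ = ∂ false P
  P₁ = ∂ true P
  d₀ d₁ : ℕ
  d₀ = degreeSum n P₀
  d₁ = degreeSum n P₁
  regroup : ∀ a c b → (a + c) + (c + b) ≡ a + 2 * c + b
  regroup = solve-∀

degreeSum-suc-∅ : ∀ n (P : WordPred (suc n)) → ∂ true P ≗ ∅ →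
                  degreeSum (suc n) P ≡ degreeSum n (∂ false P)
degreeSum-suc-∅ n P P₁≗∅ = begin
    degreeSum (suc n) P
  ≡⟨ degreeSum-suc n P ⟩
    degreeSum n (∂ false P) + 2 * count n (∂ true P ∩ ∂ false P) + degreeSum n (∂ true P)
  ≡⟨ cong₂ (λ c d → degreeSum n (∂ false P) + 2 * c + d)
           (trans (count-cong n (λ w → cong (_∧ ∂ false P w) (P₁≗∅ w))) (count-∅ n))
           (trans (degreeSum-cong n P₁≗∅) (degreeSum-∅ n)) ⟩
    degreeSum n (∂ false P) + 0 + 0
  ≡⟨ trans (+-identityʳ _) (+-identityʳ _) ⟩
    degreeSum n (∂ false P)
  ∎
  where open ≡-Reasoning

handshake : ∀ n (P : WordPred n) → 2 * inducedEdges n P ≡ degreeSum n P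
handshake n P = begin
    2 * length (filter (λ p → hamming (proj₁ p) (proj₂ p) Data.Nat.≟ 1) (pairs V))
  ≡⟨ cong (2 *_) (length-filter _ (pairs V)) ⟩
    2 * ∑ (pairs V) (λ p → χ (adjacent (proj₁ p) (proj₂ p)))
  ≡⟨ ∑-pairs (λ x y → χ (adjacent x y))
             (λ x y → cong (χ ∘ (_≡ᵇ 1)) (hamming-sym x y))
             (λ x → cong (χ ∘ (_≡ᵇ 1)) (hamming-refl x)) V ⟩
    ∑ V (λ x → ∑ V (λ y → χ (adjacent x y)))
  ≡⟨ ∑-filter P (allWords n) _ ⟩
    ∑Q n (λ x → χ (P x) * ∑ V (λ y → χ (adjacent x y)))
  ≡⟨ ∑-cong (allWords n) (λ x → trans (cong (χ (P x) *_) (∑-filter P (allWords n) _))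
                                      (sym (∑-*ˡ (allWords n) (χ (P x)) _))) ⟩
    ∑Q n (λ x → ∑Q n (λ y → χ (P x) * (χ (P y) * χ (adjacent x y))))
  ≡⟨ ∑-cong (allWords n) (λ x → ∑-cong (allWords n) (λ y → χ-∧∧ (adjacent x y) (P x) (P y))) ⟩
    degreeSum n P
  ∎
  where
  open ≡-Reasoning
  V : List (Vec Bool n)
  V = filter (λ w → P w ≟ᴮ true) (allWords n)
  rotate : ∀ x y z → y * (z * x) ≡ x * (y * z)
  rotate = solve-∀
  χ-∧∧ : ∀ a b c → χ b * (χ c * χ a) ≡ χ (a ∧ b ∧ c)
  χ-∧∧ a b c =
    trans (rotate (χ a) (χ b) (χ c)) (sym (trans (χ-∧ a (b ∧ c)) (cong (χ a *_) (χ-∧ b c))))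

fib : ℕ → ℕ
fib 0             = 0
fib 1             = 1
fib (suc (suc n)) = fib (suc n) + fib n

noTwoOnes-false∷ : ∀ xs → noTwoOnes (false ∷ xs) ≡ noTwoOnes xs
noTwoOnes-false∷ []       = refl
noTwoOnes-false∷ (x ∷ xs) = refl

noTwoOnes-true∷⇒false∷ : ∀ xs → T (noTwoOnes (true ∷ xs)) → T (noTwoOnes (false ∷ xs))
noTwoOnes-true∷⇒false∷ []           t = t
noTwoOnes-true∷⇒false∷ (false ∷ xs) t = t
noTwoOnes-true∷⇒false∷ (true ∷ xs)  ()

∂false-isFibVertex : ∂ false isFibVertex ≗ isFibVertex {n}
∂false-isFibVertex w = noTwoOnes-false∷ (toList w)

∂false-∂true-isFibVertex : ∂ false (∂ true isFibVertex) ≗ isFibVertex {n}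
∂false-∂true-isFibVertex w = noTwoOnes-false∷ (toList w)

mutual
  count-isFibVertex : ∀ n → count n isFibVertex ≡ fib (2 + n)
  count-isFibVertex zero    = refl
  count-isFibVertex (suc n) =
    trans (count-suc n isFibVertex)
          (cong₂ _+_ (trans (count-cong n ∂false-isFibVertex) (count-isFibVertex n)) (count-∂true-isFibVertex n))

  count-∂true-isFibVertex : ∀ n → count n (∂ true isFibVertex) ≡ fib (1 + n)
  count-∂true-isFibVertex zero    = refl
  count-∂true-isFibVertex (suc n) =
    trans (count-suc-∅ n (∂ true isFibVertex) (λ _ → refl))
          (trans (count-cong n ∂false-∂true-isFibVertex) (count-isFibVertex n))

degreeSum-isFibVertex-suc : ∀ n →
  degreeSum (suc n) isFibVertex ≡ degreeSum n isFibVertex + 2 * fib (1 + n) + degreeSum n (∂ true isFibVertex)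
degreeSum-isFibVertex-suc n = trans (degreeSum-suc n isFibVertex)
  (cong (_+ degreeSum n (∂ true isFibVertex))
        (cong₂ (λ a c → a + 2 * c)
               (degreeSum-cong n ∂false-isFibVertex)
               (trans (count-∩-⊆ n (λ w → noTwoOnes-true∷⇒false∷ (toList w))) (count-∂true-isFibVertex n))))

degreeSum-∂true-isFibVertex-suc : ∀ n → degreeSum (suc n) (∂ true isFibVertex) ≡ degreeSum n isFibVertex
degreeSum-∂true-isFibVertex-suc n =
  trans (degreeSum-suc-∅ n (∂ true isFibVertex) (λ _ → refl)) (degreeSum-cong n ∂false-∂true-isFibVertex)

degreeSum-isFibVertex-rec : ∀ n →
  degreeSum (2 + n) isFibVertex ≡ degreeSum (1 + n) isFibVertex + 2 * fib (2 + n) + degreeSum n isFibVertex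
degreeSum-isFibVertex-rec n =
  trans (degreeSum-isFibVertex-suc (1 + n))
        (cong (_+_ (degreeSum (1 + n) isFibVertex + 2 * fib (2 + n))) (degreeSum-∂true-isFibVertex-suc n))

-- s ≽ t: t accepts every string that s accepts. The state zeros k m still owes k + 1 − m zeros.
data _≽_ : State → State → Set where
  ones≽ones     : ∀ {k k'} → k' ≤ k → ones k ≽ ones k'
  ones≽outside  : ∀ {k} → ones k ≽ outside
  zeros≽zeros   : ∀ {k m k' m'} → m + k' ≤ m' + k → zeros k m ≽ zeros k' m'
  zeros≽outside : ∀ {k m} → zeros k m ≽ outside
  outside≽zeros : ∀ {k m} → k < m → outside ≽ zeros k m

closing-mono : ∀ k m k' m' → m + k' ≤ m' + k → T (k <ᵇ m) → T (k' <ᵇ m')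
closing-mono k m k' m' le k<m = <⇒<ᵇ (+-cancelˡ-< m k' m' (begin-strict
    m + k'  ≤⟨ le ⟩
    m' + k  <⟨ +-monoʳ-< m' (<ᵇ⇒< k m k<m) ⟩
    m' + m  ≡⟨ +-comm m' m ⟩
    m + m'  ∎))
  where open ≤-Reasoning

scan-mono : ∀ {s t} → s ≽ t → ∀ xs → T (scan s xs) → T (scan t xs)
scan-mono (ones≽ones k'≤k)     []           ()
scan-mono (ones≽ones k'≤k)     (false ∷ xs) = scan-mono (zeros≽zeros (s≤s k'≤k)) xs
scan-mono (ones≽ones k'≤k)     (true ∷ xs)  = scan-mono (ones≽ones (s≤s k'≤k)) xs
scan-mono ones≽outside         []           ()
scan-mono ones≽outside         (false ∷ xs) = scan-mono zeros≽outside xs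
scan-mono ones≽outside         (true ∷ xs)  = scan-mono (ones≽ones (s≤s z≤n)) xs
scan-mono (zeros≽zeros le)     (false ∷ xs) = scan-mono (zeros≽zeros (s≤s le)) xs
scan-mono (zeros≽zeros {k} {m} {k'} {m'} le) [] = closing-mono k m k' m' le
scan-mono (zeros≽zeros {k} {m} {k'} {m'} le) (true ∷ xs) t =
  let (k<m , rest) = Equivalence.to T-∧ t
  in  Equivalence.from T-∧ (closing-mono k m k' m' le k<m , rest)
scan-mono zeros≽outside        []           = λ _ → tt
scan-mono zeros≽outside        (false ∷ xs) = scan-mono zeros≽outside xs
scan-mono zeros≽outside        (true ∷ xs)  = proj₂ ∘ Equivalence.to T-∧
scan-mono (outside≽zeros k<m)  []           = λ _ → <⇒<ᵇ k<m
scan-mono (outside≽zeros k<m)  (false ∷ xs) = scan-mono (outside≽zeros (m<n⇒m<1+n k<m)) xs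
scan-mono (outside≽zeros k<m)  (true ∷ xs)  = λ rest → Equivalence.from T-∧ (<⇒<ᵇ k<m , rest)

accepted : State → WordPred n
accepted s w = scan s (toList w ++ false ∷ false ∷ [])

accepted-mono : ∀ {s t} → s ≽ t → accepted s ⊆ accepted {n} t
accepted-mono s≽t w = scan-mono s≽t (toList w ++ false ∷ false ∷ [])

-- From need d at least d more zeros must be read (need 0 is outside any run);
-- run j is inside a run of j + 1 ones.
need : ℕ → State
need zero    = outside
need (suc d) = zeros (suc d) 1

run : ℕ → State
run j = ones (suc j)

∂false-need : ∀ d → ∂ false (accepted (need (suc d))) ≗ accepted {n} (need d)
∂false-need zero    w =
  T-injective (accepted-mono zeros≽outside w) (accepted-mono (outside≽zeros (s≤s (s≤s z≤n))) w)
∂false-need (suc d) w =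
  T-injective (accepted-mono (zeros≽zeros ≤-refl) w) (accepted-mono (zeros≽zeros ≤-refl) w)

count-need-suc : ∀ d n → count (suc n) (accepted (need (suc d))) ≡ count n (accepted (need d))
count-need-suc d n =
  trans (count-suc-∅ n (accepted (need (suc d))) (λ _ → refl)) (count-cong n (∂false-need d))

degreeSum-need-suc : ∀ d n → degreeSum (suc n) (accepted (need (suc d))) ≡ degreeSum n (accepted (need d))
degreeSum-need-suc d n =
  trans (degreeSum-suc-∅ n (accepted (need (suc d))) (λ _ → refl)) (degreeSum-cong n (∂false-need d))

count-run∩need-suc : ∀ j n →
  count (suc n) (accepted (run (suc j)) ∩ accepted (need (suc j))) ≡ count n (accepted (need (suc (suc j))))
count-run∩need-suc j n =
  trans (count-suc-∅ n (accepted (run (suc j)) ∩ accepted (need (suc j))) (λ w → ∧-zeroʳ _))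
        (count-∩-⊆ n (accepted-mono (zeros≽zeros (m≤n+m _ 2))))

count-run∩need-shift : ∀ j n →
  count (suc n) (accepted (run (suc (suc j))) ∩ accepted (need (suc (suc j))))
  ≡ count n (accepted (run (suc j)) ∩ accepted (need (suc j)))
count-run∩need-shift j zero    = count-run∩need-suc (suc j) zero
count-run∩need-shift j (suc n) =
  trans (count-run∩need-suc (suc j) (suc n))
        (trans (count-need-suc (suc (suc j)) n) (sym (count-run∩need-suc j n)))

diagonal-invariance : (X Y : ℕ → ℕ → ℕ) →
  (∀ j n → X j (suc n) ≡ Y (suc j) n + X (suc j) n) →
  (∀ j n → Y (suc (suc j)) (suc n) ≡ Y (suc j) n) →
  (∀ j → X (suc j) 1 ≡ X j 0) →
  ∀ j n → X (suc j) (suc n) ≡ X j n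
diagonal-invariance X Y step Y-inv base j zero    = base j
diagonal-invariance X Y step Y-inv base j (suc n) =
  trans (step (suc j) (suc n))
        (trans (cong₂ _+_ (Y-inv j n) (diagonal-invariance X Y step Y-inv base (suc j) n)) (sym (step j n)))

count-run-shift : ∀ j n → count (suc n) (accepted (run (suc j))) ≡ count n (accepted (run j))
count-run-shift = diagonal-invariance (λ j n → count n (accepted (run j))) (λ d n → count n (accepted (need d)))
  (λ j n → count-suc n (accepted (run j))) (λ j → count-need-suc (suc j)) (λ j → refl)

degreeSum-run-shift : ∀ j n → degreeSum (suc n) (accepted (run (suc j))) ≡ degreeSum n (accepted (run j))
degreeSum-run-shift = diagonal-invariance
  (λ j n → degreeSum n (accepted (run j)))
  (λ d n → degreeSum n (accepted (need d)) + 2 * count n (accepted (run d) ∩ accepted (need d)))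
  (λ j n → degreeSum-suc n (accepted (run j)))
  (λ j n → cong₂ (λ a c → a + 2 * c) (degreeSum-need-suc (suc j) n) (count-run∩need-shift j n))
  (λ j → degreeSum-suc 0 (accepted (run (suc j))))

mutual
  count-need₀ : ∀ n → count n (accepted (need 0)) ≡ fib (2 + n)
  count-need₀ zero    = refl
  count-need₀ (suc n) = trans (count-suc n (accepted (need 0))) (cong₂ _+_ (count-need₀ n) (count-run₀ n))

  count-run₀ : ∀ n → count n (accepted (run 0)) ≡ fib (1 + n)
  count-run₀ zero    = refl
  count-run₀ (suc n) = trans (count-suc n (accepted (run 0))) (cong₂ _+_ (count-need₁ n) (count-run₁ n))

  count-need₁ : ∀ n → count n (accepted (need 1)) ≡ fib (1 + n)
  count-need₁ zero    = refl
  count-need₁ (suc n) = trans (count-need-suc 0 n) (count-need₀ n)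

  count-run₁ : ∀ n → count n (accepted (run 1)) ≡ fib n
  count-run₁ zero    = refl
  count-run₁ (suc n) = trans (count-run-shift 0 n) (count-run₀ n)

degreeSum-isRunVertex-suc : ∀ n →
  degreeSum (suc n) isRunVertex ≡ degreeSum n isRunVertex + 2 * fib (1 + n) + degreeSum n (∂ true isRunVertex)
degreeSum-isRunVertex-suc n = trans (degreeSum-suc n isRunVertex)
  (cong (λ c → degreeSum n isRunVertex + 2 * c + degreeSum n (∂ true isRunVertex))
        (trans (count-∩-⊆ n (accepted-mono ones≽outside)) (count-run₀ n)))

degreeSum-∂true-isRunVertex-rec : ∀ n → degreeSum (3 + n) (∂ true isRunVertex)
  ≡ degreeSum (1 + n) isRunVertex + 2 * fib (1 + n) + degreeSum (1 + n) (∂ true isRunVertex)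
degreeSum-∂true-isRunVertex-rec n = trans (degreeSum-suc (2 + n) (accepted (run 0)))
  (cong₂ _+_ (cong₂ (λ a c → a + 2 * c)
                    (degreeSum-need-suc 0 (1 + n))
                    (trans (count-run∩need-suc 0 (1 + n)) (trans (count-need-suc 1 n) (count-need₁ n))))
             (degreeSum-run-shift 0 (1 + n)))

degreeSum-isRunVertex-rec : ∀ n → degreeSum (4 + n) isRunVertex + 2 * fib n
  ≡ degreeSum (3 + n) isRunVertex + 2 * fib (4 + n) + degreeSum (2 + n) isRunVertex
degreeSum-isRunVertex-rec n = begin
    D (4 + n) + 2 * fib n
  ≡⟨ cong (_+ 2 * fib n) (trans (degreeSum-isRunVertex-suc (3 + n))
                                 (cong (_+_ (D (3 + n) + 2 * fib (4 + n))) (degreeSum-∂true-isRunVertex-rec n))) ⟩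
    D (3 + n) + 2 * fib (4 + n) + (D (1 + n) + 2 * fib (1 + n) + D₁ (1 + n)) + 2 * fib n
  ≡⟨ regroup (D (3 + n) + 2 * fib (4 + n)) (D (1 + n)) (fib (1 + n)) (fib n) (D₁ (1 + n)) ⟩
    D (3 + n) + 2 * fib (4 + n) + (D (1 + n) + 2 * fib (2 + n) + D₁ (1 + n))
  ≡⟨ cong (_+_ (D (3 + n) + 2 * fib (4 + n))) (sym (degreeSum-isRunVertex-suc (1 + n))) ⟩
    D (3 + n) + 2 * fib (4 + n) + D (2 + n)
  ∎
  where
  open ≡-Reasoning
  D D₁ : ℕ → ℕ
  D k = degreeSum k isRunVertex
  D₁ k = degreeSum k (∂ true isRunVertex)
  regroup : ∀ a r f g d → a + (r + 2 * f + d) + 2 * g ≡ a + (r + 2 * (f + g) + d)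
  regroup = solve-∀

*-distribˡ-+₃ : ∀ a x y z → a * (x + y + z) ≡ a * x + a * y + a * z
*-distribˡ-+₃ = solve-∀

edgesΓ-rec : ∀ n → edgesΓ (2 + n) ≡ edgesΓ (1 + n) + fib (2 + n) + edgesΓ n
edgesΓ-rec n = *-cancelˡ-≡ _ _ 2 (begin
    2 * edgesΓ (2 + n)
  ≡⟨ handshake (2 + n) isFibVertex ⟩
    degreeSum (2 + n) isFibVertex
  ≡⟨ degreeSum-isFibVertex-rec n ⟩
    degreeSum (1 + n) isFibVertex + 2 * fib (2 + n) + degreeSum n isFibVertex
  ≡⟨ sym (cong₂ (λ a b → a + 2 * fib (2 + n) + b)
                (handshake (1 + n) isFibVertex) (handshake n isFibVertex)) ⟩
    2 * edgesΓ (1 + n) + 2 * fib (2 + n) + 2 * edgesΓ n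
  ≡⟨ sym (*-distribˡ-+₃ 2 (edgesΓ (1 + n)) (fib (2 + n)) (edgesΓ n)) ⟩
    2 * (edgesΓ (1 + n) + fib (2 + n) + edgesΓ n)
  ∎)
  where open ≡-Reasoning

edgesR-rec : ∀ n → edgesR (4 + n) + fib n ≡ edgesR (3 + n) + fib (4 + n) + edgesR (2 + n)
edgesR-rec n = *-cancelˡ-≡ _ _ 2 (begin
    2 * (edgesR (4 + n) + fib n)
  ≡⟨ *-distribˡ-+ 2 (edgesR (4 + n)) (fib n) ⟩
    2 * edgesR (4 + n) + 2 * fib n
  ≡⟨ cong (_+ 2 * fib n) (handshake (4 + n) isRunVertex) ⟩
    degreeSum (4 + n) isRunVertex + 2 * fib n
  ≡⟨ degreeSum-isRunVertex-rec n ⟩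
    degreeSum (3 + n) isRunVertex + 2 * fib (4 + n) + degreeSum (2 + n) isRunVertex
  ≡⟨ sym (cong₂ (λ a b → a + 2 * fib (4 + n) + b)
                (handshake (3 + n) isRunVertex) (handshake (2 + n) isRunVertex)) ⟩
    2 * edgesR (3 + n) + 2 * fib (4 + n) + 2 * edgesR (2 + n)
  ≡⟨ sym (*-distribˡ-+₃ 2 (edgesR (3 + n)) (fib (4 + n)) (edgesR (2 + n))) ⟩
    2 * (edgesR (3 + n) + fib (4 + n) + edgesR (2 + n))
  ∎)
  where open ≡-Reasoning

edgesR+edgesΓ : ∀ n → edgesR (4 + n) + edgesΓ n ≡ edgesΓ (4 + n)
edgesR+edgesΓ 0             = refl
edgesR+edgesΓ 1             = refl
edgesR+edgesΓ (suc (suc n)) = begin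
    edgesR (6 + n) + edgesΓ (2 + n)
  ≡⟨ cong (_+_ (edgesR (6 + n))) (edgesΓ-rec n) ⟩
    edgesR (6 + n) + (edgesΓ (1 + n) + fib (2 + n) + edgesΓ n)
  ≡⟨ regroup₁ (edgesR (6 + n)) (edgesΓ (1 + n)) (fib (2 + n)) (edgesΓ n) ⟩
    (edgesR (6 + n) + fib (2 + n)) + edgesΓ (1 + n) + edgesΓ n
  ≡⟨ cong (λ x → x + edgesΓ (1 + n) + edgesΓ n) (edgesR-rec (2 + n)) ⟩
    (edgesR (5 + n) + fib (6 + n) + edgesR (4 + n)) + edgesΓ (1 + n) + edgesΓ n
  ≡⟨ regroup₂ (edgesR (5 + n)) (fib (6 + n)) (edgesR (4 + n)) (edgesΓ (1 + n)) (edgesΓ n) ⟩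
    (edgesR (5 + n) + edgesΓ (1 + n)) + fib (6 + n) + (edgesR (4 + n) + edgesΓ n)
  ≡⟨ cong₂ (λ a b → a + fib (6 + n) + b) (edgesR+edgesΓ (suc n)) (edgesR+edgesΓ n) ⟩
    edgesΓ (5 + n) + fib (6 + n) + edgesΓ (4 + n)
  ≡⟨ sym (edgesΓ-rec (4 + n)) ⟩
    edgesΓ (6 + n)
  ∎
  where
  open ≡-Reasoning
  regroup₁ : ∀ r g f h → r + (g + f + h) ≡ (r + f) + g + h
  regroup₁ = solve-∀
  regroup₂ : ∀ r f r' g h → (r + f + r') + g + h ≡ (r + g) + f + (r' + h)
  regroup₂ = solve-∀

edgesR-gf-rec : ∀ n → edgesR (6 + n) + 2 * edgesR (3 + n) + edgesR (2 + n) ≡ 2 * edgesR (5 + n) + edgesR (4 + n)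
edgesR-gf-rec n = +-cancelʳ-≡ K _ _ (begin
    r 6 + 2 * r 3 + r 2 + K
  ≡⟨ regroup₁ (r 6) (r 3) (r 2) (r 4) (F 1) (F 0) (F 5) (F 4) ⟩
    (r 6 + F 2) + (r 4 + F 5 + r 3) + (r 3 + F 4 + r 2)
  ≡⟨ cong₂ _+_ (cong₂ _+_ (edgesR-rec (2 + n)) (sym (edgesR-rec (1 + n)))) (sym (edgesR-rec n)) ⟩
    (r 5 + F 6 + r 4) + (r 5 + F 1) + (r 4 + F 0)
  ≡⟨ regroup₂ (r 5) (r 4) (F 1) (F 0) (F 5) (F 4) ⟩
    2 * r 5 + r 4 + K
  ∎)
  where
  open ≡-Reasoning
  r F : ℕ → ℕ
  r k = edgesR (k + n)
  F k = fib (k + n)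
  K : ℕ
  K = r 4 + F 1 + F 0 + F 5 + F 4
  regroup₁ : ∀ r₆ r₃ r₂ r₄ f₁ f₀ f₅ f₄ →
    r₆ + 2 * r₃ + r₂ + (r₄ + f₁ + f₀ + f₅ + f₄)
    ≡ (r₆ + (f₁ + f₀)) + (r₄ + f₅ + r₃) + (r₃ + f₄ + r₂)
  regroup₁ = solve-∀
  regroup₂ : ∀ r₅ r₄ f₁ f₀ f₅ f₄ →
    (r₅ + (f₅ + f₄) + r₄) + (r₅ + f₁) + (r₄ + f₀)
    ≡ 2 * r₅ + r₄ + (r₄ + f₁ + f₀ + f₅ + f₄)
  regroup₂ = solve-∀

squaredDenominator : Series
squaredDenominator = oneMinusTMinusT² ⊛ oneMinusTMinusT²

sumTo-stable : ∀ N m (f : ℕ → ℤ) → (∀ j → f (suc (N + j)) ≡ + 0) → sumTo (N + m) f ≡ sumTo N f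
sumTo-stable N zero    f vanishes = cong (λ k → sumTo k f) (+-identityʳ N)
sumTo-stable N (suc m) f vanishes = begin
    sumTo (N + suc m) f
  ≡⟨ cong (λ k → sumTo k f) (+-suc N m) ⟩
    sumTo (N + m) f ℤ.+ f (suc (N + m))
  ≡⟨ cong₂ ℤ._+_ (sumTo-stable N m f vanishes) (vanishes m) ⟩
    sumTo N f ℤ.+ + 0
  ≡⟨ ℤᵖ.+-identityʳ (sumTo N f) ⟩
    sumTo N f
  ∎
  where open ≡-Reasoning

squaredDenominator-vanishes : ∀ j → squaredDenominator (5 + j) ≡ + 0
squaredDenominator-vanishes j = sumTo-stable 0 (5 + j) _ vanishes
  where
  vanishes : ∀ i → oneMinusTMinusT² (suc i) ℤ.* oneMinusTMinusT² (5 + j ∸ suc i) ≡ + 0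
  vanishes 0             = refl
  vanishes 1             = refl
  vanishes (suc (suc i)) = refl

gf-coefficient : ∀ k → (squaredDenominator ⊛ edgeGF) (6 + k) ≡ + 0
gf-coefficient k = begin
    (squaredDenominator ⊛ edgeGF) (6 + k)
  ≡⟨ sumTo-stable 4 (2 + k) _
       (λ j → cong (ℤ._* edgeGF (6 + k ∸ (5 + j))) (squaredDenominator-vanishes j)) ⟩
    sumTo 4 (λ i → squaredDenominator i ℤ.* edgeGF (6 + k ∸ i))
  ≡⟨ expand (r 6) (r 5) (r 4) (r 3) (r 2) ⟩
    (r 6 ℤ.+ + 2 ℤ.* r 3 ℤ.+ r 2) - (+ 2 ℤ.* r 5 ℤ.+ r 4)
  ≡⟨ cong₂ _-_ (sym (cast₃ (edgesR (6 + k)) (edgesR (3 + k)) (edgesR (2 + k))))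
               (sym (cast₂ (edgesR (5 + k)) (edgesR (4 + k)))) ⟩
    + (edgesR (6 + k) + 2 * edgesR (3 + k) + edgesR (2 + k)) - + (2 * edgesR (5 + k) + edgesR (4 + k))
  ≡⟨ cong (λ x → + x - + (2 * edgesR (5 + k) + edgesR (4 + k))) (edgesR-gf-rec k) ⟩
    + (2 * edgesR (5 + k) + edgesR (4 + k)) - + (2 * edgesR (5 + k) + edgesR (4 + k))
  ≡⟨ ℤᵖ.+-inverseʳ (+ (2 * edgesR (5 + k) + edgesR (4 + k))) ⟩
    + 0
  ∎
  where
  open ≡-Reasoning
  r : ℕ → ℤ
  r i = + edgesR (i + k)
  q : ℕ → ℤ
  q = squaredDenominator
  expand : ∀ x y z u v →
    q 0 ℤ.* x ℤ.+ q 1 ℤ.* y ℤ.+ q 2 ℤ.* z ℤ.+ q 3 ℤ.* u ℤ.+ q 4 ℤ.* v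
    ≡ (x ℤ.+ + 2 ℤ.* u ℤ.+ v) - (+ 2 ℤ.* y ℤ.+ z)
  expand = ℤSolver.solve-∀
  cast₂ : ∀ a b → + (2 * a + b) ≡ + 2 ℤ.* + a ℤ.+ + b
  cast₂ a b = trans (ℤᵖ.pos-+ (2 * a) b) (cong (ℤ._+ + b) (ℤᵖ.pos-* 2 a))
  cast₃ : ∀ a b c → + (a + 2 * b + c) ≡ + a ℤ.+ + 2 ℤ.* + b ℤ.+ + c
  cast₃ a b c = trans (ℤᵖ.pos-+ (a + 2 * b) c)
    (cong (ℤ._+ + c) (trans (ℤᵖ.pos-+ a (2 * b)) (cong (ℤ._+_ (+ a)) (ℤᵖ.pos-* 2 b))))

edge-generating-function : ∀ m → (squaredDenominator ⊛ edgeGF) m ≡ tTimesOneMinusT⁴ m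
edge-generating-function 0 = refl
edge-generating-function 1 = refl
edge-generating-function 2 = refl
edge-generating-function 3 = refl
edge-generating-function 4 = refl
edge-generating-function 5 = refl
edge-generating-function (suc (suc (suc (suc (suc (suc k)))))) = gf-coefficient k

edgesR-as-difference : (n : ℕ) → 5 ≤ n → + edgesR n ≡ + edgesΓ n - + edgesΓ (n ∸ 4)
edgesR-as-difference _ (s≤s (s≤s (s≤s (s≤s {n = n} _)))) = begin
    + edgesR (4 + n)
  ≡⟨ sym (cancel (+ edgesR (4 + n)) (+ edgesΓ n)) ⟩
    + edgesR (4 + n) ℤ.+ + edgesΓ n - + edgesΓ n
  ≡⟨ cong (_- + edgesΓ n)
          (trans (sym (ℤᵖ.pos-+ (edgesR (4 + n)) (edgesΓ n))) (cong +_ (edgesR+edgesΓ n))) ⟩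
    + edgesΓ (4 + n) - + edgesΓ n
  ∎
  where
  open ≡-Reasoning
  cancel : ∀ x y → x ℤ.+ y - y ≡ x
  cancel = ℤSolver.solve-∀

lemma3p3 : ((n : ℕ) → 5 ≤ n → + edgesR n ≡ + edgesΓ n - + edgesΓ (n ∸ 4))
           × (((m : ℕ) → ((oneMinusTMinusT² ⊛ oneMinusTMinusT²) ⊛ edgeGF) m ≡ tTimesOneMinusT⁴ m)
           × (edgesR 1 ≡ 1 × edgesR 2 ≡ 2 × edgesR 3 ≡ 5 × edgesR 4 ≡ 10 × edgesR 5 ≡ 19 × edgesR 6 ≡ 36))
lemma3p3 = edgesR-as-difference , edge-generating-function , refl , refl , refl , refl , refl , refl
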